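{- Let $v_1,\ldots,v_m\in\mathbb{R}^d$, let $k\ge d$ be an integer and let $x\in\mathbb{R}^m_{\ge0}$ with $\sum_{i=1}^m x(i)=k$. Let $u_1,\ldots,u_k$ be i.i.d. random vectors, each equal to $v_j$ with probability $x(j)/k$ for $j\in[m]$, and define \[ f_\emptyset(y)=\mathbb{E}\Big[\det\Big(y I_d-\sum_{j=1}^k u_ju_j^\top\Big)\Big]. \] Let $X=\sum_{i=1}^m x(i)v_iv_i^\top$. Then \[ (-1)^d f_\emptyset(0)=\frac{k!}{(k-d)!\,k^d}\det(X). \] -}

module Defs where

open import Level using (Level)
open import Algebra.Bundles using (CommutativeRing)
open import Data.Nat as ℕ using (ℕ; zero; suc)
open import Data.Fin using (Fin; zero; suc; toℕ; punchIn; _≟_)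
open import Relation.Nullary using (yes; no)

-- All definitions are relative to a commutative ring R (the paper uses ℝ).
module RingDefs {c ℓ : Level} (R : CommutativeRing c ℓ) where
  open CommutativeRing R using (Carrier; _+_; _*_; -_; _-_; 0#; 1#)

  Σ : (n : ℕ) → (Fin n → Carrier) → Carrier
  Σ zero    f = 0#
  Σ (suc n) f = f zero + Σ n (λ i → f (suc i))

  Π : (n : ℕ) → (Fin n → Carrier) → Carrier
  Π zero    f = 1#
  Π (suc n) f = f zero * Π n (λ i → f (suc i))

  ⟦_⟧ : ℕ → Carrier
  ⟦ zero ⟧  = 0#
  ⟦ suc n ⟧ = 1# + ⟦ n ⟧

  pow : Carrier → ℕ → Carrier
  pow a zero    = 1#
  pow a (suc n) = a * pow a n

  sgn : ℕ → Carrier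
  sgn n = pow (- 1#) n

  Vector : ℕ → Set c
  Vector d = Fin d → Carrier

  Matrix : ℕ → Set c
  Matrix d = Fin d → Fin d → Carrier

  det : (d : ℕ) → Matrix d → Carrier
  det zero    M = 1#
  det (suc d) M = Σ (suc d) λ j →
    sgn (toℕ j) * (M zero j * det d (λ r s → M (suc r) (punchIn j s)))

  I : (d : ℕ) → Matrix d
  I d i j with i ≟ j
  ... | yes _ = 1#
  ... | no  _ = 0#

  scal : (d : ℕ) → Carrier → Matrix d → Matrix d
  scal d y M i j = y * M i j

  _⊟_ : {d : ℕ} → Matrix d → Matrix d → Matrix d
  (A ⊟ B) i j = A i j - B i j

  outer : {d : ℕ} → Vector d → Matrix d
  outer v i j = v i * v j

  ΣM : {d : ℕ} (n : ℕ) → (Fin n → Matrix d) → Matrix d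
  ΣM n F i j = Σ n (λ a → F a i j)

  cons : {k m : ℕ} → Fin m → (Fin k → Fin m) → (Fin (suc k) → Fin m)
  cons j t zero    = j
  cons j t (suc i) = t i

  ΣTuples : (k m : ℕ) → ((Fin k → Fin m) → Carrier) → Carrier
  ΣTuples zero    m F = F (λ ())
  ΣTuples (suc k) m F = Σ m (λ j → ΣTuples k m (λ t → F (cons j t)))

  -- Expectation over u_1..u_k i.i.d., u_j = v_a with probability p a:
  -- E[G] = Σ_{t : [k] → [m]} (Π_j p (t j)) · G t
  Expect : (k m : ℕ) → (p : Fin m → Carrier) → ((Fin k → Fin m) → Carrier) → Carrier
  Expect k m p G = ΣTuples k m (λ t → Π k (λ j → p (t j)) * G t)

  -- f_∅(y) = E[ det(y I_d − Σ_{j=1}^k u_j u_jᵀ) ], with P(u_j = v_a) = x(a) · k⁻¹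
  fEmpty : (d m k : ℕ) (v : Fin m → Vector d) (x : Fin m → Carrier)
           (kinv : Carrier) (y : Carrier) → Carrier
  fEmpty d m k v x kinv y =
    Expect k m (λ a → x a * kinv)
      (λ t → det d (scal d y (I d) ⊟ ΣM k (λ j → outer (v (t j)))))

  Xmat : (d m : ℕ) (v : Fin m → Vector d) (x : Fin m → Carrier) → Matrix d
  Xmat d m v x = ΣM m (λ i r s → x i * outer (v i) r s)

  -- falling factorial k!/(k-d)! = k (k-1) ... (k-d+1)
  falling : ℕ → ℕ → ℕ
  falling k zero    = 1
  falling k (suc d) = k ℕ.* falling (k ℕ.∸ 1) d

{-# OPTIONS --safe #-}
module Submission where

-- Since det (0·I − S) = (−1)^d det S, the left-hand side is E[det S] for S = Σⱼ uⱼ uⱼᵀ.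
-- Expanding det S by multilinearity in the rows gives a sum over maps σ : [d] → [k] of
-- Πᵣ u_{σ r}(r) · det(u_{σ 1}, …, u_{σ d}); the terms with σ non-injective vanish since
-- the determinant is alternating.  For injective σ the u_{σ r} are again d i.i.d. samples,
-- so each of the k!/(k−d)! injections contributes the same expectation, and the same row
-- expansion applied to X = Σᵢ x(i) vᵢ vᵢᵀ identifies it with k^{−d} det X.
-- As det is defined by Laplace expansion along the first row, it is shown to be
-- alternating by expanding along the first two rows, where the terms cancel in pairs.

open import Defs
open import Level using (Level; _⊔_)
open import Algebra.Bundles using (CommutativeRing)
open import Data.Nat as ℕ using (ℕ; zero; suc; _≤_)
open import Data.Fin using (Fin; zero; suc; toℕ; punchIn; punchOut; _≟_)
open import Data.Fin.Properties using (suc-injective; punchInᵢ≢i; punchOut-cong; punchOut-punchIn)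
open import Data.Empty using (⊥-elim)
open import Relation.Nullary using (yes; no)
open import Data.Product using (∃₂; _×_; _,_)
open import Relation.Binary.Core using (_Preserves_⟶_)
open import Function using (_∘_)
open import Relation.Binary.PropositionalEquality as ≡ using (_≡_; _≢_; _≗_)
import Algebra.Properties.CommutativeSemigroup as CommSemigroupProperties
import Algebra.Properties.Ring as RingProperties
import Algebra.Properties.Group as GroupProperties
import Relation.Binary.Reasoning.Setoid as ≈-Reasoning

module Summation {c ℓ : Level} (R : CommutativeRing c ℓ) where
  open CommutativeRing R hiding (zero)
  open RingDefs R
  open CommSemigroupProperties +-commutativeSemigroup
    using () renaming (interchange to +-interchange; x∙yz≈y∙xz to +-leftComm)
  open CommSemigroupProperties *-commutativeSemigroup
    using () renaming (interchange to *-interchange)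

  Σ-cong : ∀ n {f g : Fin n → Carrier} → (∀ i → f i ≈ g i) → Σ n f ≈ Σ n g
  Σ-cong zero    _   = refl
  Σ-cong (suc n) f≈g = +-cong (f≈g zero) (Σ-cong n (f≈g ∘ suc))

  Σ-zero : ∀ n {f : Fin n → Carrier} → (∀ i → f i ≈ 0#) → Σ n f ≈ 0#
  Σ-zero zero    _   = refl
  Σ-zero (suc n) f≈0 = trans (+-cong (f≈0 zero) (Σ-zero n (f≈0 ∘ suc))) (+-identityˡ 0#)

  Σ-distrib-+ : ∀ n (f g : Fin n → Carrier) → Σ n (λ i → f i + g i) ≈ Σ n f + Σ n g
  Σ-distrib-+ zero    _ _ = sym (+-identityˡ 0#)
  Σ-distrib-+ (suc n) f g =
    trans (+-congˡ (Σ-distrib-+ n (f ∘ suc) (g ∘ suc))) (+-interchange _ _ _ _)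

  *-distribˡ-Σ : ∀ n a (f : Fin n → Carrier) → a * Σ n f ≈ Σ n (λ i → a * f i)
  *-distribˡ-Σ zero    a _ = zeroʳ a
  *-distribˡ-Σ (suc n) a f = trans (distribˡ a _ _) (+-congˡ (*-distribˡ-Σ n a (f ∘ suc)))

  *-distribʳ-Σ : ∀ n a (f : Fin n → Carrier) → Σ n f * a ≈ Σ n (λ i → f i * a)
  *-distribʳ-Σ zero    a _ = zeroˡ a
  *-distribʳ-Σ (suc n) a f = trans (distribʳ a _ _) (+-congˡ (*-distribʳ-Σ n a (f ∘ suc)))

  Σ-comm : ∀ n m (f : Fin n → Fin m → Carrier) →
           Σ n (λ i → Σ m (f i)) ≈ Σ m (λ j → Σ n (λ i → f i j))
  Σ-comm zero    m _ = sym (Σ-zero m (λ _ → refl))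
  Σ-comm (suc n) m f = trans (+-congˡ (Σ-comm n m (f ∘ suc))) (sym (Σ-distrib-+ m _ _))

  Σ-const : ∀ n a → Σ n (λ _ → a) ≈ ⟦ n ⟧ * a
  Σ-const zero    a = sym (zeroˡ a)
  Σ-const (suc n) a =
    trans (+-cong (sym (*-identityˡ a)) (Σ-const n a)) (sym (distribʳ a 1# ⟦ n ⟧))

  Σ-punchIn : ∀ n (i : Fin (suc n)) (f : Fin (suc n) → Carrier) →
              Σ (suc n) f ≈ f i + Σ n (f ∘ punchIn i)
  Σ-punchIn _       zero    _ = refl
  Σ-punchIn (suc n) (suc i) f =
    trans (+-congˡ (Σ-punchIn n i (f ∘ suc))) (+-leftComm (f zero) (f (suc i)) _)

  Σ-offDiagonal : ∀ n → (Fin (suc n) → Fin (suc n) → Carrier) → Carrier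
  Σ-offDiagonal n g = Σ (suc n) (λ a → Σ n (λ t → g a (punchIn a t)))

  Σ-offDiagonal-distrib-+ : ∀ n (f g : Fin (suc n) → Fin (suc n) → Carrier) →
    Σ-offDiagonal n (λ a b → f a b + g a b) ≈ Σ-offDiagonal n f + Σ-offDiagonal n g
  Σ-offDiagonal-distrib-+ n f g =
    trans (Σ-cong (suc n) (λ a → Σ-distrib-+ n (λ t → f a (punchIn a t)) (λ t → g a (punchIn a t))))
          (Σ-distrib-+ (suc n) (λ a → Σ n (λ t → f a (punchIn a t))) (λ a → Σ n (λ t → g a (punchIn a t))))

  Σ-offDiagonal-cancel : ∀ n (g : Fin (suc n) → Fin (suc n) → Carrier) →
                         (∀ a b → a ≢ b → g a b + g b a ≈ 0#) → Σ-offDiagonal n g ≈ 0#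
  Σ-offDiagonal-cancel zero    _ _ = +-identityˡ 0#
  Σ-offDiagonal-cancel (suc n) g cancel = begin
    Σ (suc n) (λ b → g zero (suc b))
      + Σ (suc n) (λ a → g (suc a) zero + Σ n (λ t → g (suc a) (suc (punchIn a t))))
      ≈⟨ +-congˡ (Σ-distrib-+ (suc n) (λ a → g (suc a) zero)
                                         (λ a → Σ n (λ t → g (suc a) (suc (punchIn a t))))) ⟩
    Σ (suc n) (λ b → g zero (suc b))
      + (Σ (suc n) (λ a → g (suc a) zero) + Σ-offDiagonal n (λ a b → g (suc a) (suc b)))
      ≈⟨ +-assoc _ _ _ ⟨
    (Σ (suc n) (λ b → g zero (suc b)) + Σ (suc n) (λ a → g (suc a) zero))
      + Σ-offDiagonal n (λ a b → g (suc a) (suc b))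
      ≈⟨ +-cong (trans (sym (Σ-distrib-+ (suc n) (λ b → g zero (suc b)) (λ a → g (suc a) zero)))
                       (Σ-zero (suc n) (λ b → cancel zero (suc b) (λ ()))))
                (Σ-offDiagonal-cancel n (λ a b → g (suc a) (suc b))
                                      (λ a b a≢b → cancel (suc a) (suc b) (a≢b ∘ suc-injective))) ⟩
    0# + 0#
      ≈⟨ +-identityˡ 0# ⟩
    0#  ∎
    where open ≈-Reasoning setoid

  Π-cong : ∀ n {f g : Fin n → Carrier} → (∀ i → f i ≈ g i) → Π n f ≈ Π n g
  Π-cong zero    _   = refl
  Π-cong (suc n) f≈g = *-cong (f≈g zero) (Π-cong n (f≈g ∘ suc))

  Π-distrib-* : ∀ n (f g : Fin n → Carrier) → Π n (λ i → f i * g i) ≈ Π n f * Π n g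
  Π-distrib-* zero    _ _ = sym (*-identityˡ 1#)
  Π-distrib-* (suc n) f g =
    trans (*-congˡ (Π-distrib-* n (f ∘ suc) (g ∘ suc))) (*-interchange _ _ _ _)

  Π-const : ∀ n a → Π n (λ _ → a) ≈ pow a n
  Π-const zero    _ = refl
  Π-const (suc n) a = *-congˡ (Π-const n a)

  ⟦⟧-+ : ∀ a b → ⟦ a ℕ.+ b ⟧ ≈ ⟦ a ⟧ + ⟦ b ⟧
  ⟦⟧-+ zero    _ = sym (+-identityˡ _)
  ⟦⟧-+ (suc a) b = trans (+-congˡ (⟦⟧-+ a b)) (sym (+-assoc _ _ _))

  ⟦⟧-* : ∀ a b → ⟦ a ℕ.* b ⟧ ≈ ⟦ a ⟧ * ⟦ b ⟧
  ⟦⟧-* zero    _ = sym (zeroˡ _)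
  ⟦⟧-* (suc a) b =
    trans (⟦⟧-+ b (a ℕ.* b)) (trans (+-cong (sym (*-identityˡ _)) (⟦⟧-* a b)) (sym (distribʳ _ _ _)))

NonInjective : ∀ {d k} → (Fin d → Fin k) → Set
NonInjective σ = ∃₂ λ r₁ r₂ → r₁ ≢ r₂ × σ r₁ ≡ σ r₂

module Tuples {c ℓ : Level} (R : CommutativeRing c ℓ) where
  open CommutativeRing R hiding (zero)
  open RingDefs R
  open Summation R

  ΣTuples-cong : ∀ k m {F G : (Fin k → Fin m) → Carrier} →
                 (∀ t → F t ≈ G t) → ΣTuples k m F ≈ ΣTuples k m G
  ΣTuples-cong zero    m F≈G = F≈G _
  ΣTuples-cong (suc k) m F≈G = Σ-cong m (λ j → ΣTuples-cong k m (F≈G ∘ cons j))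

  ΣTuples-zero : ∀ k m {F : (Fin k → Fin m) → Carrier} → (∀ t → F t ≈ 0#) → ΣTuples k m F ≈ 0#
  ΣTuples-zero zero    m F≈0 = F≈0 _
  ΣTuples-zero (suc k) m F≈0 = Σ-zero m (λ j → ΣTuples-zero k m (F≈0 ∘ cons j))

  *-distribˡ-ΣTuples : ∀ k m a (F : (Fin k → Fin m) → Carrier) →
                       a * ΣTuples k m F ≈ ΣTuples k m (λ t → a * F t)
  *-distribˡ-ΣTuples zero    _ _ _ = refl
  *-distribˡ-ΣTuples (suc k) m a F =
    trans (*-distribˡ-Σ m a _) (Σ-cong m (λ j → *-distribˡ-ΣTuples k m a (F ∘ cons j)))

  ΣTuples-Σ-comm : ∀ k m n (F : (Fin k → Fin m) → Fin n → Carrier) →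
                   ΣTuples k m (λ t → Σ n (F t)) ≈ Σ n (λ i → ΣTuples k m (λ t → F t i))
  ΣTuples-Σ-comm zero    _ _ _ = refl
  ΣTuples-Σ-comm (suc k) m n F =
    trans (Σ-cong m (λ j → ΣTuples-Σ-comm k m n (F ∘ cons j))) (Σ-comm m n _)

  ΣTuples-comm : ∀ k m k′ m′ (F : (Fin k → Fin m) → (Fin k′ → Fin m′) → Carrier) →
                 ΣTuples k m (λ t → ΣTuples k′ m′ (F t)) ≈
                 ΣTuples k′ m′ (λ σ → ΣTuples k m (λ t → F t σ))
  ΣTuples-comm zero    _ _ _ _ = refl
  ΣTuples-comm (suc k) m k′ m′ F =
    trans (Σ-cong m (λ j → ΣTuples-comm k m k′ m′ (F ∘ cons j))) (sym (ΣTuples-Σ-comm k′ m′ m _))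

  cons-cong : ∀ {k m} {a : Fin m} {σ σ′ : Fin k → Fin m} → σ ≗ σ′ → cons a σ ≗ cons a σ′
  cons-cong _   zero    = ≡.refl
  cons-cong σ≗σ′ (suc i) = σ≗σ′ i

  cons-punchIn : ∀ {k m} (j : Fin (suc m)) a (σ : Fin k → Fin m) →
                 cons (punchIn j a) (punchIn j ∘ σ) ≗ punchIn j ∘ cons a σ
  cons-punchIn _ _ _ zero    = ≡.refl
  cons-punchIn _ _ _ (suc _) = ≡.refl

  ΣTuples-avoid : ∀ d k (j : Fin (suc k)) (F : (Fin d → Fin (suc k)) → Carrier) →
                  F Preserves _≗_ ⟶ _≈_ → (∀ σ r → σ r ≡ j → F σ ≈ 0#) →
                  ΣTuples d (suc k) F ≈ ΣTuples d k (λ σ → F (punchIn j ∘ σ))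
  ΣTuples-avoid zero    _ _ _ F-cong _ = F-cong (λ ())
  ΣTuples-avoid (suc d) k j F F-cong F≈0 = begin
    Σ (suc k) (λ a → ΣTuples d (suc k) (F ∘ cons a))
      ≈⟨ Σ-punchIn k j (λ a → ΣTuples d (suc k) (F ∘ cons a)) ⟩
    ΣTuples d (suc k) (F ∘ cons j) + Σ k (λ a → ΣTuples d (suc k) (F ∘ cons (punchIn j a)))
      ≈⟨ +-cong (ΣTuples-zero d (suc k) (λ σ → F≈0 (cons j σ) zero ≡.refl))
                (Σ-cong k (λ a → ΣTuples-avoid d k j (F ∘ cons (punchIn j a))
                                   (F-cong ∘ cons-cong) (λ σ r → F≈0 _ (suc r)))) ⟩
    0# + Σ k (λ a → ΣTuples d k (λ σ → F (cons (punchIn j a) (punchIn j ∘ σ))))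
      ≈⟨ +-identityˡ _ ⟩
    Σ k (λ a → ΣTuples d k (λ σ → F (cons (punchIn j a) (punchIn j ∘ σ))))
      ≈⟨ Σ-cong k (λ a → ΣTuples-cong d k (λ σ → F-cong (cons-punchIn j a σ))) ⟩
    Σ k (λ a → ΣTuples d k (λ σ → F (punchIn j ∘ cons a σ)))  ∎
    where open ≈-Reasoning setoid

  consInj : ∀ {d k} → Fin (suc k) → (Fin d → Fin k) → Fin (suc d) → Fin (suc k)
  consInj j σ = cons j (punchIn j ∘ σ)

  -- Every injection Fin (suc d) → Fin (suc k) is consInj j σ for a unique j and injection σ.
  ΣInjections : (d k : ℕ) → ((Fin d → Fin k) → Carrier) → Carrier
  ΣInjections zero    k       F = F (λ ())
  ΣInjections (suc d) zero    F = 0#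
  ΣInjections (suc d) (suc k) F =
    Σ (suc k) (λ j → ΣInjections d k (F ∘ consInj j))

  ΣInjections-cong : ∀ d k {F G : (Fin d → Fin k) → Carrier} →
                     (∀ σ → F σ ≈ G σ) → ΣInjections d k F ≈ ΣInjections d k G
  ΣInjections-cong zero    k       F≈G = F≈G _
  ΣInjections-cong (suc d) zero    _   = refl
  ΣInjections-cong (suc d) (suc k) F≈G =
    Σ-cong (suc k) (λ j → ΣInjections-cong d k (F≈G ∘ consInj j))

  *-distribˡ-ΣInjections : ∀ d k a (F : (Fin d → Fin k) → Carrier) →
                           a * ΣInjections d k F ≈ ΣInjections d k (λ σ → a * F σ)
  *-distribˡ-ΣInjections zero    _       _ _ = refl
  *-distribˡ-ΣInjections (suc d) zero    a F = zeroʳ a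
  *-distribˡ-ΣInjections (suc d) (suc k) a F =
    trans (*-distribˡ-Σ (suc k) a (λ j → ΣInjections d k (F ∘ consInj j)))
          (Σ-cong (suc k) (λ j → *-distribˡ-ΣInjections d k a (F ∘ consInj j)))

  ΣInjections-Σ-comm : ∀ d k n (F : (Fin d → Fin k) → Fin n → Carrier) →
                       ΣInjections d k (λ σ → Σ n (F σ)) ≈ Σ n (λ i → ΣInjections d k (λ σ → F σ i))
  ΣInjections-Σ-comm zero    _       _ _ = refl
  ΣInjections-Σ-comm (suc d) zero    n _ = sym (Σ-zero n (λ _ → refl))
  ΣInjections-Σ-comm (suc d) (suc k) n F =
    trans (Σ-cong (suc k) (λ j → ΣInjections-Σ-comm d k n (F ∘ consInj j)))
          (Σ-comm (suc k) n (λ j i → ΣInjections d k (λ σ → F (consInj j σ) i)))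

  ΣTuples≈ΣInjections : ∀ d k (F : (Fin d → Fin k) → Carrier) → F Preserves _≗_ ⟶ _≈_ →
                        (∀ σ → NonInjective σ → F σ ≈ 0#) → ΣTuples d k F ≈ ΣInjections d k F
  ΣTuples≈ΣInjections zero    _       _ _ _ = refl
  ΣTuples≈ΣInjections (suc d) zero    _ _ _ = refl
  ΣTuples≈ΣInjections (suc d) (suc k) F F-cong F≈0 = Σ-cong (suc k) λ j →
    trans (ΣTuples-avoid d k j (F ∘ cons j) (F-cong ∘ cons-cong)
                         (λ σ r σr≡j → F≈0 _ (zero , suc r , (λ ()) , ≡.sym σr≡j)))
          (ΣTuples≈ΣInjections d k (F ∘ consInj j)
                               (F-cong ∘ cons-cong ∘ (≡.cong (punchIn j) ∘_))
                               (λ { σ (r₁ , r₂ , r₁≢r₂ , σr₁≡σr₂) →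
                                    F≈0 _ (suc r₁ , suc r₂ , r₁≢r₂ ∘ suc-injective ,
                                           ≡.cong (punchIn j) σr₁≡σr₂) }))

punchIn₂ : ∀ {n} {a b : Fin (suc (suc n))} → a ≢ b → Fin n → Fin (suc (suc n))
punchIn₂ {a = a} a≢b = punchIn a ∘ punchIn (punchOut a≢b)

punchIn₂-sym : ∀ {n} {a b : Fin (suc (suc n))} (a≢b : a ≢ b) (b≢a : b ≢ a) →
               punchIn₂ a≢b ≗ punchIn₂ b≢a
punchIn₂-sym {a = zero}  {zero}  a≢b _ _ = ⊥-elim (a≢b ≡.refl)
punchIn₂-sym {a = zero}  {suc _} _   _ _ = ≡.refl
punchIn₂-sym {a = suc _} {zero}  _   _ _ = ≡.refl
punchIn₂-sym {suc _} {suc _} {suc _} _ _ zero = ≡.refl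
punchIn₂-sym {suc n} {suc a} {suc b} a≢b b≢a (suc u) =
  ≡.cong suc (punchIn₂-sym (a≢b ∘ ≡.cong suc) (b≢a ∘ ≡.cong suc) u)

module Determinant {c ℓ : Level} (R : CommutativeRing c ℓ) where
  open CommutativeRing R hiding (zero)
  open RingDefs R
  open Summation R
  open Tuples R
  open RingProperties ring using (-1*x≈-x; -‿involutive; -‿distribˡ-*)
  open CommSemigroupProperties *-commutativeSemigroup
    using () renaming (interchange to *-interchange; x∙yz≈y∙xz to *-leftComm)
  open CommSemigroupProperties +-commutativeSemigroup using () renaming (interchange to +-interchange)
  open GroupProperties +-group using (inverseʳ-unique; ε⁻¹≈ε)

  -1*x*-1*y≈x*y : ∀ x y → (- 1# * x) * (- 1# * y) ≈ x * y
  -1*x*-1*y≈x*y x y = begin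
    (- 1# * x) * (- 1# * y)  ≈⟨ *-interchange (- 1#) x (- 1#) y ⟩
    (- 1# * - 1#) * (x * y)  ≈⟨ *-congʳ (trans (-1*x≈-x (- 1#)) (-‿involutive 1#)) ⟩
    1# * (x * y)             ≈⟨ *-identityˡ (x * y) ⟩
    x * y                    ∎
    where open ≈-Reasoning setoid

  sgn-square : ∀ d → sgn d * sgn d ≈ 1#
  sgn-square zero    = *-identityˡ 1#
  sgn-square (suc d) = trans (-1*x*-1*y≈x*y (sgn d) (sgn d)) (sgn-square d)

  minor : ∀ {d} → Fin (suc d) → Matrix (suc d) → Matrix d
  minor j M r s = M (suc r) (punchIn j s)

  laplaceTerm : ∀ d → Matrix (suc d) → Fin (suc d) → Carrier
  laplaceTerm d M j = sgn (toℕ j) * (M zero j * det d (minor j M))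

  det-cong : ∀ d {M N : Matrix d} → (∀ r s → M r s ≈ N r s) → det d M ≈ det d N
  det-cong zero            _   = refl
  det-cong (suc d) {M} {N} M≈N = Σ-cong (suc d) termwise
    where
    termwise : ∀ j → laplaceTerm d M j ≈ laplaceTerm d N j
    termwise j = *-congˡ (*-cong (M≈N zero j) (det-cong d (λ r s → M≈N (suc r) (punchIn j s))))

  det-scale : ∀ d a (M : Matrix d) → det d (λ r s → a * M r s) ≈ pow a d * det d M
  det-scale zero    _ _ = sym (*-identityˡ 1#)
  det-scale (suc d) a M =
    trans (Σ-cong (suc d) termwise) (sym (*-distribˡ-Σ (suc d) (pow a (suc d)) (laplaceTerm d M)))
    where
    termwise : ∀ j → laplaceTerm d (λ r s → a * M r s) j ≈ pow a (suc d) * laplaceTerm d M j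
    termwise j = begin
      sgn (toℕ j) * ((a * M zero j) * det d (λ r s → a * minor j M r s))
        ≈⟨ *-congˡ (*-congˡ (det-scale d a (minor j M))) ⟩
      sgn (toℕ j) * ((a * M zero j) * (pow a d * det d (minor j M)))
        ≈⟨ *-congˡ (*-interchange a (M zero j) (pow a d) _) ⟩
      sgn (toℕ j) * (pow a (suc d) * (M zero j * det d (minor j M)))
        ≈⟨ *-leftComm (sgn (toℕ j)) (pow a (suc d)) _ ⟩
      pow a (suc d) * laplaceTerm d M j  ∎
      where open ≈-Reasoning setoid

  pairSign : ∀ {n} {a b : Fin (suc (suc n))} → a ≢ b → Carrier
  pairSign {a = a} a≢b = sgn (toℕ a) * sgn (toℕ (punchOut a≢b))

  pairSign-antisym : ∀ {n} {a b : Fin (suc (suc n))} (a≢b : a ≢ b) (b≢a : b ≢ a) →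
                     pairSign a≢b ≈ - pairSign b≢a
  pairSign-antisym {a = zero} {zero} a≢b _ = ⊥-elim (a≢b ≡.refl)
  pairSign-antisym {a = zero} {suc b} _ _ = begin
    1# * sgn (toℕ b)             ≈⟨ *-identityˡ _ ⟩
    sgn (toℕ b)                  ≈⟨ -‿involutive _ ⟨
    - (- sgn (toℕ b))            ≈⟨ -‿cong (-1*x≈-x _) ⟨
    - sgn (suc (toℕ b))          ≈⟨ -‿cong (*-identityʳ _) ⟨
    - (sgn (suc (toℕ b)) * 1#)   ∎
    where open ≈-Reasoning setoid
  pairSign-antisym {a = suc a} {zero} _ _ = begin
    sgn (suc (toℕ a)) * 1#       ≈⟨ *-identityʳ _ ⟩
    - 1# * sgn (toℕ a)           ≈⟨ -1*x≈-x _ ⟩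
    - sgn (toℕ a)                ≈⟨ -‿cong (*-identityˡ _) ⟨
    - (1# * sgn (toℕ a))         ∎
    where open ≈-Reasoning setoid
  pairSign-antisym {zero} {suc zero} {suc zero} a≢b _ = ⊥-elim (a≢b ≡.refl)
  pairSign-antisym {suc n} {suc a} {suc b} a≢b b≢a =
    trans (-1*x*-1*y≈x*y _ _)
          (trans (pairSign-antisym (a≢b ∘ ≡.cong suc) (b≢a ∘ ≡.cong suc))
                 (-‿cong (sym (-1*x*-1*y≈x*y _ _))))

  module PairExpansion {n} (rest : Fin n → Vector (suc (suc n))) where

    pairMinor : ∀ {a b : Fin (suc (suc n))} → a ≢ b → Carrier
    pairMinor a≢b = det n (λ r → rest r ∘ punchIn₂ a≢b)

    -- The term of the expansion along first rows x, y that uses column a of x and column b of y;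
    -- the diagonal a ≡ b never occurs and gets the junk value 0#.
    pairTerm : (x y : Vector (suc (suc n))) → Fin (suc (suc n)) → Fin (suc (suc n)) → Carrier
    pairTerm x y a b with a ≟ b
    ... | yes _   = 0#
    ... | no a≢b = pairSign a≢b * (x a * (y b * pairMinor a≢b))

    pairTerm-punchIn : ∀ x y a t → pairTerm x y a (punchIn a t) ≈
      (sgn (toℕ a) * sgn (toℕ t)) * (x a * (y (punchIn a t) * det n (λ r → rest r ∘ punchIn a ∘ punchIn t)))
    pairTerm-punchIn x y a t with a ≟ punchIn a t
    ... | yes a≡a′ = ⊥-elim (punchInᵢ≢i a t (≡.sym a≡a′))
    ... | no a≢a′ = reflexive (≡.cong (λ t′ → (sgn (toℕ a) * sgn (toℕ t′)) *
                                              (x a * (y (punchIn a t) * det n (λ r → rest r ∘ punchIn a ∘ punchIn t′))))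
                                      (≡.trans (punchOut-cong a ≡.refl) (punchOut-punchIn a)))

    pairTerm-cancel : ∀ {x y x′ y′} → (∀ s → x s ≈ y′ s) → (∀ s → y s ≈ x′ s) →
                      ∀ a b → a ≢ b → pairTerm x y a b + pairTerm x′ y′ b a ≈ 0#
    pairTerm-cancel {x} {y} {x′} {y′} x≈y′ y≈x′ a b a≢b with a ≟ b | b ≟ a
    ... | yes a≡b | _       = ⊥-elim (a≢b a≡b)
    ... | no _    | yes b≡a = ⊥-elim (a≢b (≡.sym b≡a))
    ... | no a≢b′ | no b≢a  = begin
      P + pairSign b≢a * (x′ b * (y′ a * pairMinor b≢a))
        ≈⟨ +-congˡ (*-cong (pairSign-antisym b≢a a≢b′) swapped) ⟩
      P + (- pairSign a≢b′) * (x a * (y b * pairMinor a≢b′))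
        ≈⟨ +-congˡ (-‿distribˡ-* _ _) ⟨
      P + - P
        ≈⟨ -‿inverseʳ P ⟩
      0#  ∎
      where
      open ≈-Reasoning setoid
      P : Carrier
      P = pairSign a≢b′ * (x a * (y b * pairMinor a≢b′))
      swapped : x′ b * (y′ a * pairMinor b≢a) ≈ x a * (y b * pairMinor a≢b′)
      swapped = trans (*-cong (sym (y≈x′ b)) (*-congʳ (sym (x≈y′ a))))
                      (trans (*-leftComm (y b) (x a) _)
                             (*-congˡ (*-congˡ (det-cong n λ r s →
                               reflexive (≡.cong (rest r) (punchIn₂-sym b≢a a≢b′ s))))))

  det-pairExpansion : ∀ n (M : Matrix (suc (suc n))) →
    det (suc (suc n)) M ≈
    Σ-offDiagonal (suc n) (PairExpansion.pairTerm (λ r → M (suc (suc r))) (M zero) (M (suc zero)))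
  det-pairExpansion n M = Σ-cong (suc (suc n)) termwise
    where
    open PairExpansion (λ r → M (suc (suc r)))
    termwise : ∀ a → laplaceTerm (suc n) M a ≈ Σ (suc n) (λ t → pairTerm (M zero) (M (suc zero)) a (punchIn a t))
    termwise a = begin
      sgn (toℕ a) * (M zero a * Σ (suc n) (laplaceTerm n (minor a M)))
        ≈⟨ *-congˡ (*-distribˡ-Σ (suc n) (M zero a) (laplaceTerm n (minor a M))) ⟩
      sgn (toℕ a) * Σ (suc n) (λ t → M zero a * laplaceTerm n (minor a M) t)
        ≈⟨ *-distribˡ-Σ (suc n) (sgn (toℕ a)) (λ t → M zero a * laplaceTerm n (minor a M) t) ⟩
      Σ (suc n) (λ t → sgn (toℕ a) * (M zero a * laplaceTerm n (minor a M) t))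
        ≈⟨ Σ-cong (suc n) regroup ⟩
      Σ (suc n) (λ t → pairTerm (M zero) (M (suc zero)) a (punchIn a t))  ∎
      where
      open ≈-Reasoning setoid
      regroup : ∀ t → sgn (toℕ a) * (M zero a * laplaceTerm n (minor a M) t) ≈
                      pairTerm (M zero) (M (suc zero)) a (punchIn a t)
      regroup t = trans (*-congˡ (*-leftComm (M zero a) (sgn (toℕ t)) _))
                        (trans (sym (*-assoc _ _ _)) (sym (pairTerm-punchIn _ _ a t)))

  swapTop : ∀ {n} → Matrix (suc (suc n)) → Matrix (suc (suc n))
  swapTop M zero          = M (suc zero)
  swapTop M (suc zero)    = M zero
  swapTop M (suc (suc r)) = M (suc (suc r))

  det-equalTopRows : ∀ n (M : Matrix (suc (suc n))) → (∀ s → M zero s ≈ M (suc zero) s) →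
                     det (suc (suc n)) M ≈ 0#
  det-equalTopRows n M M₀≈M₁ =
    trans (det-pairExpansion n M) (Σ-offDiagonal-cancel (suc n) _ (pairTerm-cancel M₀≈M₁ (sym ∘ M₀≈M₁)))
    where open PairExpansion (λ r → M (suc (suc r)))

  det-swapTop : ∀ n (M : Matrix (suc (suc n))) → det (suc (suc n)) (swapTop M) ≈ - det (suc (suc n)) M
  det-swapTop n M = inverseʳ-unique (det (suc (suc n)) M) _ (begin
    det (suc (suc n)) M + det (suc (suc n)) (swapTop M)
      ≈⟨ +-cong (det-pairExpansion n M) (det-pairExpansion n (swapTop M)) ⟩
    Σ-offDiagonal (suc n) (pairTerm x y) + Σ-offDiagonal (suc n) (pairTerm y x)
      ≈⟨ Σ-offDiagonal-distrib-+ (suc n) (pairTerm x y) (pairTerm y x) ⟨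
    Σ-offDiagonal (suc n) (λ a b → pairTerm x y a b + pairTerm y x a b)
      ≈⟨ Σ-offDiagonal-cancel (suc n) _ cancel ⟩
    0#  ∎)
    where
    open ≈-Reasoning setoid
    open PairExpansion (λ r → M (suc (suc r)))
    x y : Vector (suc (suc n))
    x = M zero
    y = M (suc zero)
    cancel : ∀ a b → a ≢ b → (pairTerm x y a b + pairTerm y x a b) + (pairTerm x y b a + pairTerm y x b a) ≈ 0#
    cancel a b a≢b = begin
      (pairTerm x y a b + pairTerm y x a b) + (pairTerm x y b a + pairTerm y x b a)
        ≈⟨ +-congˡ (+-comm _ _) ⟩
      (pairTerm x y a b + pairTerm y x a b) + (pairTerm y x b a + pairTerm x y b a)
        ≈⟨ +-interchange _ _ _ _ ⟩
      (pairTerm x y a b + pairTerm y x b a) + (pairTerm y x a b + pairTerm x y b a)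
        ≈⟨ +-cong (pairTerm-cancel (λ _ → refl) (λ _ → refl) a b a≢b)
                  (pairTerm-cancel (λ _ → refl) (λ _ → refl) a b a≢b) ⟩
      0# + 0#
        ≈⟨ +-identityˡ 0# ⟩
      0#  ∎

  Alternating : ℕ → Set (c ⊔ ℓ)
  Alternating d = ∀ (M : Matrix d) {a b : Fin d} → a ≢ b → (∀ s → M a s ≈ M b s) → det d M ≈ 0#

  det-equalLowerRows : ∀ {d} → Alternating d → ∀ (M : Matrix (suc d)) {a b : Fin d} → a ≢ b →
                       (∀ s → M (suc a) s ≈ M (suc b) s) → det (suc d) M ≈ 0#
  det-equalLowerRows {d} alternating M a≢b Ma≈Mb = Σ-zero (suc d) termwise
    where
    termwise : ∀ j → laplaceTerm d M j ≈ 0#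
    termwise j = trans (*-congˡ (trans (*-congˡ (alternating (minor j M) a≢b (Ma≈Mb ∘ punchIn j)))
                                       (zeroʳ _)))
                       (zeroʳ _)

  -- Swapping the first two rows moves the repeated row into the minors.
  det-equalRow₀ : ∀ {d} → Alternating d → ∀ (M : Matrix (suc d)) b →
                  (∀ s → M zero s ≈ M (suc b) s) → det (suc d) M ≈ 0#
  det-equalRow₀ {suc n} _           M zero    M₀≈M₁ = det-equalTopRows n M M₀≈M₁
  det-equalRow₀ {suc n} alternating M (suc b) M₀≈Mb = begin
    det (suc (suc n)) M               ≈⟨ -‿involutive _ ⟨
    - (- det (suc (suc n)) M)         ≈⟨ -‿cong (det-swapTop n M) ⟨
    - det (suc (suc n)) (swapTop M)   ≈⟨ -‿cong (det-equalLowerRows alternating (swapTop M) {zero} {suc b}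
                                                                   (λ ()) M₀≈Mb) ⟩
    - 0#                              ≈⟨ ε⁻¹≈ε ⟩
    0#                                ∎
    where open ≈-Reasoning setoid

  det-alternating : ∀ d → Alternating d
  det-alternating (suc d) M {zero}  {zero}  a≢b _     = ⊥-elim (a≢b ≡.refl)
  det-alternating (suc d) M {zero}  {suc b} _   M₀≈Mb = det-equalRow₀ (det-alternating d) M b M₀≈Mb
  det-alternating (suc d) M {suc a} {zero}  _   Ma≈M₀ = det-equalRow₀ (det-alternating d) M a (sym ∘ Ma≈M₀)
  det-alternating (suc d) M {suc a} {suc b} a≢b Ma≈Mb =
    det-equalLowerRows (det-alternating d) M (a≢b ∘ ≡.cong suc) Ma≈Mb

  det-product-expansion : ∀ d k (A : Fin d → Fin k → Carrier) (B : Fin k → Vector d) →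
    det d (λ r s → Σ k (λ j → A r j * B j s)) ≈
    ΣTuples d k (λ σ → Π d (λ r → A r (σ r)) * det d (B ∘ σ))
  det-product-expansion zero    _ _ _ = sym (*-identityˡ 1#)
  det-product-expansion (suc d) k A B = begin
    Σ (suc d) (laplaceTerm d AB)
      ≈⟨ Σ-cong (suc d) expandRow₀ ⟩
    Σ (suc d) (λ s → Σ k (λ j → ΣTuples d k (term s j)))
      ≈⟨ Σ-comm (suc d) k (λ s j → ΣTuples d k (term s j)) ⟩
    Σ k (λ j → Σ (suc d) (λ s → ΣTuples d k (term s j)))
      ≈⟨ Σ-cong k (λ j → sym (ΣTuples-Σ-comm d k (suc d) (λ σ s → term s j σ))) ⟩
    Σ k (λ j → ΣTuples d k (λ σ → Σ (suc d) (λ s → term s j σ)))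
      ≈⟨ Σ-cong k (λ j → ΣTuples-cong d k (factor j)) ⟩
    ΣTuples (suc d) k (λ σ → Π (suc d) (λ r → A r (σ r)) * det (suc d) (B ∘ σ))  ∎
    where
    open ≈-Reasoning setoid
    AB : Matrix (suc d)
    AB r s = Σ k (λ j → A r j * B j s)
    π : (Fin d → Fin k) → Carrier
    π σ = Π d (λ r → A (suc r) (σ r))
    D : (Fin d → Fin k) → Fin (suc d) → Carrier
    D σ s = det d (λ r → B (σ r) ∘ punchIn s)
    term : Fin (suc d) → Fin k → (Fin d → Fin k) → Carrier
    term s j σ = sgn (toℕ s) * ((A zero j * B j s) * (π σ * D σ s))
    expandRow₀ : ∀ s → laplaceTerm d AB s ≈ Σ k (λ j → ΣTuples d k (term s j))
    expandRow₀ s = begin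
      sgn (toℕ s) * (AB zero s * det d (minor s AB))
        ≈⟨ *-congˡ (*-congˡ (det-product-expansion d k (A ∘ suc) (λ j → B j ∘ punchIn s))) ⟩
      sgn (toℕ s) * (AB zero s * ΣTuples d k (λ σ → π σ * D σ s))
        ≈⟨ *-congˡ (*-distribʳ-Σ k _ (λ j → A zero j * B j s)) ⟩
      sgn (toℕ s) * Σ k (λ j → (A zero j * B j s) * ΣTuples d k (λ σ → π σ * D σ s))
        ≈⟨ *-distribˡ-Σ k (sgn (toℕ s)) _ ⟩
      Σ k (λ j → sgn (toℕ s) * ((A zero j * B j s) * ΣTuples d k (λ σ → π σ * D σ s)))
        ≈⟨ Σ-cong k (λ j → *-congˡ (*-distribˡ-ΣTuples d k (A zero j * B j s) (λ σ → π σ * D σ s))) ⟩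
      Σ k (λ j → sgn (toℕ s) * ΣTuples d k (λ σ → (A zero j * B j s) * (π σ * D σ s)))
        ≈⟨ Σ-cong k (λ j → *-distribˡ-ΣTuples d k (sgn (toℕ s)) _) ⟩
      Σ k (λ j → ΣTuples d k (term s j))  ∎
    factor : ∀ j σ → Σ (suc d) (λ s → term s j σ) ≈ (A zero j * π σ) * det (suc d) (B ∘ cons j σ)
    factor j σ = begin
      Σ (suc d) (λ s → sgn (toℕ s) * ((A zero j * B j s) * (π σ * D σ s)))
        ≈⟨ Σ-cong (suc d) regroup ⟩
      Σ (suc d) (λ s → (A zero j * π σ) * (sgn (toℕ s) * (B j s * D σ s)))
        ≈⟨ *-distribˡ-Σ (suc d) (A zero j * π σ) (λ s → sgn (toℕ s) * (B j s * D σ s)) ⟨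
      (A zero j * π σ) * det (suc d) (B ∘ cons j σ)  ∎
      where
      regroup : ∀ s → term s j σ ≈ (A zero j * π σ) * (sgn (toℕ s) * (B j s * D σ s))
      regroup s = trans (*-congˡ (*-interchange (A zero j) (B j s) (π σ) (D σ s)))
                        (*-leftComm (sgn (toℕ s)) (A zero j * π σ) (B j s * D σ s))

  sgn-det-negate : ∀ d (M : Matrix d) → sgn d * det d (scal d 0# (I d) ⊟ M) ≈ det d M
  sgn-det-negate d M = begin
    sgn d * det d (scal d 0# (I d) ⊟ M)   ≈⟨ *-congˡ (det-cong d (λ r s → negate (I d r s) (M r s))) ⟩
    sgn d * det d (λ r s → - 1# * M r s)  ≈⟨ *-congˡ (det-scale d (- 1#) M) ⟩
    sgn d * (sgn d * det d M)             ≈⟨ *-assoc _ _ _ ⟨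
    (sgn d * sgn d) * det d M             ≈⟨ *-congʳ (sgn-square d) ⟩
    1# * det d M                          ≈⟨ *-identityˡ _ ⟩
    det d M                               ∎
    where
    open ≈-Reasoning setoid
    negate : ∀ a b → 0# * a - b ≈ - 1# * b
    negate a b = trans (+-congʳ (zeroˡ a)) (trans (+-identityˡ (- b)) (sym (-1*x≈-x b)))

module Gram {c ℓ : Level} (R : CommutativeRing c ℓ) where
  open CommutativeRing R hiding (zero)
  open RingDefs R
  open Summation R
  open Tuples R
  open Determinant R
  open CommSemigroupProperties *-commutativeSemigroup using (xy∙z≈y∙xz)

  diagDet : ∀ {d} → (Fin d → Vector d) → Carrier
  diagDet {d} w = Π d (λ r → w r r) * det d w

  diagDet-cong : ∀ {d} {w w′ : Fin d → Vector d} → w ≗ w′ → diagDet w ≈ diagDet w′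
  diagDet-cong {d} w≗w′ = *-cong (Π-cong d (λ r → reflexive (≡.cong-app (w≗w′ r) r)))
                                 (det-cong d (λ r s → reflexive (≡.cong-app (w≗w′ r) s)))

  diagDet-nonInjective : ∀ {d k} (w : Fin k → Vector d) σ → NonInjective σ → diagDet (w ∘ σ) ≈ 0#
  diagDet-nonInjective {d} w σ (r₁ , r₂ , r₁≢r₂ , σr₁≡σr₂) =
    trans (*-congˡ (det-alternating d (w ∘ σ) r₁≢r₂ (reflexive ∘ ≡.cong-app (≡.cong w σr₁≡σr₂))))
          (zeroʳ _)

  det-gram : ∀ d k (w : Fin k → Vector d) →
             det d (ΣM k (λ j → outer (w j))) ≈ ΣTuples d k (λ σ → diagDet (w ∘ σ))
  det-gram d k w = det-product-expansion d k (λ r j → w j r) w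

  det-Xmat : ∀ d m (v : Fin m → Vector d) (x : Fin m → Carrier) →
             det d (Xmat d m v x) ≈ ΣTuples d m (λ τ → Π d (x ∘ τ) * diagDet (v ∘ τ))
  det-Xmat d m v x = begin
    det d (Xmat d m v x)
      ≈⟨ det-cong d (λ r s → Σ-cong m (λ i → sym (*-assoc (x i) (v i r) (v i s)))) ⟩
    det d (λ r s → Σ m (λ i → (x i * v i r) * v i s))
      ≈⟨ det-product-expansion d m (λ r i → x i * v i r) v ⟩
    ΣTuples d m (λ τ → Π d (λ r → x (τ r) * v (τ r) r) * det d (v ∘ τ))
      ≈⟨ ΣTuples-cong d m (λ τ → trans (*-congʳ (Π-distrib-* d (x ∘ τ) (λ r → v (τ r) r)))
                                       (*-assoc _ _ _)) ⟩
    ΣTuples d m (λ τ → Π d (x ∘ τ) * diagDet (v ∘ τ))  ∎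
    where open ≈-Reasoning setoid

  Expect-diagDet : ∀ d m (v : Fin m → Vector d) (x : Fin m → Carrier) a →
    Expect d m (λ i → x i * a) (λ τ → diagDet (v ∘ τ)) ≈ pow a d * det d (Xmat d m v x)
  Expect-diagDet d m v x a = begin
    ΣTuples d m (λ τ → Π d (λ r → x (τ r) * a) * diagDet (v ∘ τ))
      ≈⟨ ΣTuples-cong d m (λ τ → trans (*-congʳ (Π-distrib-* d (x ∘ τ) (λ _ → a)))
                                       (trans (*-congʳ (*-congˡ (Π-const d a))) (xy∙z≈y∙xz _ _ _))) ⟩
    ΣTuples d m (λ τ → pow a d * (Π d (x ∘ τ) * diagDet (v ∘ τ)))
      ≈⟨ *-distribˡ-ΣTuples d m (pow a d) _ ⟨
    pow a d * ΣTuples d m (λ τ → Π d (x ∘ τ) * diagDet (v ∘ τ))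
      ≈⟨ *-congˡ (det-Xmat d m v x) ⟨
    pow a d * det d (Xmat d m v x)  ∎
    where open ≈-Reasoning setoid

module Expectation {c ℓ : Level} (R : CommutativeRing c ℓ) {m : ℕ} (p : Fin m → CommutativeRing.Carrier R) where
  open CommutativeRing R hiding (zero)
  open RingDefs R
  open Summation R
  open Tuples R
  open CommSemigroupProperties *-commutativeSemigroup using () renaming (x∙yz≈y∙xz to *-leftComm)

  Expect-cong : ∀ k {F G : (Fin k → Fin m) → Carrier} → (∀ t → F t ≈ G t) → Expect k m p F ≈ Expect k m p G
  Expect-cong k F≈G = ΣTuples-cong k m (*-congˡ ∘ F≈G)

  Expect-zero : ∀ k {F : (Fin k → Fin m) → Carrier} → (∀ t → F t ≈ 0#) → Expect k m p F ≈ 0#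
  Expect-zero k F≈0 = ΣTuples-zero k m (λ t → trans (*-congˡ (F≈0 t)) (zeroʳ _))

  *-distribˡ-Expect : ∀ k a (F : (Fin k → Fin m) → Carrier) → a * Expect k m p F ≈ Expect k m p (λ t → a * F t)
  *-distribˡ-Expect k a F =
    trans (*-distribˡ-ΣTuples k m a _) (ΣTuples-cong k m (λ t → *-leftComm a _ (F t)))

  Expect-suc : ∀ k (F : (Fin (suc k) → Fin m) → Carrier) →
               Expect (suc k) m p F ≈ Σ m (λ a → p a * Expect k m p (F ∘ cons a))
  Expect-suc k F = Σ-cong m λ a →
    trans (ΣTuples-cong k m (λ t → *-assoc (p a) _ (F (cons a t))))
          (sym (*-distribˡ-ΣTuples k m (p a) (λ t → Π k (λ i → p (t i)) * F (cons a t))))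

  Expect-const : Σ m p ≈ 1# → ∀ k a → Expect k m p (λ _ → a) ≈ a
  Expect-const _    zero    a = *-identityˡ a
  Expect-const Σp≈1 (suc k) a = begin
    Expect (suc k) m p (λ _ → a)              ≈⟨ Expect-suc k (λ _ → a) ⟩
    Σ m (λ b → p b * Expect k m p (λ _ → a))  ≈⟨ Σ-cong m (λ b → *-congˡ (Expect-const Σp≈1 k a)) ⟩
    Σ m (λ b → p b * a)                       ≈⟨ *-distribʳ-Σ m a p ⟨
    Σ m p * a                                 ≈⟨ *-congʳ Σp≈1 ⟩
    1# * a                                    ≈⟨ *-identityˡ a ⟩
    a                                         ∎
    where open ≈-Reasoning setoid

  Expect-ΣTuples-comm : ∀ k d n (G : (Fin k → Fin m) → (Fin d → Fin n) → Carrier) →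
    Expect k m p (λ t → ΣTuples d n (G t)) ≈ ΣTuples d n (λ σ → Expect k m p (λ t → G t σ))
  Expect-ΣTuples-comm k d n G =
    trans (ΣTuples-cong k m (λ t → *-distribˡ-ΣTuples d n _ (G t)))
          (ΣTuples-comm k m d n (λ t σ → Π k (λ i → p (t i)) * G t σ))

  Expect-splitAt : ∀ k (j : Fin (suc k)) (G : Fin m → (Fin k → Fin m) → Carrier) →
                   (∀ a → G a Preserves _≗_ ⟶ _≈_) →
                   Expect (suc k) m p (λ t → G (t j) (t ∘ punchIn j)) ≈ Σ m (λ a → p a * Expect k m p (G a))
  Expect-splitAt k       zero    G _      = Expect-suc k (λ t → G (t zero) (t ∘ suc))
  Expect-splitAt (suc k) (suc j) G G-cong = begin
    Expect (suc (suc k)) m p (λ t → G (t (suc j)) (t ∘ punchIn (suc j)))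
      ≈⟨ Expect-suc (suc k) (λ t → G (t (suc j)) (t ∘ punchIn (suc j))) ⟩
    Σ m (λ b → p b * Expect (suc k) m p (λ t → G (t j) (cons b t ∘ punchIn (suc j))))
      ≈⟨ Σ-cong m (λ b → *-congˡ (Expect-cong (suc k) (λ t → G-cong (t j) (cons-punchIn-suc b t)))) ⟩
    Σ m (λ b → p b * Expect (suc k) m p (λ t → G (t j) (cons b (t ∘ punchIn j))))
      ≈⟨ Σ-cong m (λ b → *-congˡ (Expect-splitAt k j (λ a → G a ∘ cons b)
                                                 (λ a → G-cong a ∘ cons-cong))) ⟩
    Σ m (λ b → p b * Σ m (λ a → p a * Expect k m p (G a ∘ cons b)))
      ≈⟨ Σ-cong m (λ b → *-distribˡ-Σ m (p b) _) ⟩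
    Σ m (λ b → Σ m (λ a → p b * (p a * Expect k m p (G a ∘ cons b))))
      ≈⟨ Σ-comm m m _ ⟩
    Σ m (λ a → Σ m (λ b → p b * (p a * Expect k m p (G a ∘ cons b))))
      ≈⟨ Σ-cong m (λ a → trans (Σ-cong m (λ b → *-leftComm (p b) (p a) _)) (sym (*-distribˡ-Σ m (p a) _))) ⟩
    Σ m (λ a → p a * Σ m (λ b → p b * Expect k m p (G a ∘ cons b)))
      ≈⟨ Σ-cong m (λ a → *-congˡ (sym (Expect-suc k (G a)))) ⟩
    Σ m (λ a → p a * Expect (suc k) m p (G a))  ∎
    where
    open ≈-Reasoning setoid
    cons-punchIn-suc : ∀ b (t : Fin (suc k) → Fin m) → cons b t ∘ punchIn (suc j) ≗ cons b (t ∘ punchIn j)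
    cons-punchIn-suc b t zero    = ≡.refl
    cons-punchIn-suc b t (suc i) = ≡.refl

  ΣInjections-Expect-∘ : Σ m p ≈ 1# → ∀ d k (H : (Fin d → Fin m) → Carrier) → H Preserves _≗_ ⟶ _≈_ →
    ΣInjections d k (λ σ → Expect k m p (λ t → H (t ∘ σ))) ≈ ⟦ falling k d ⟧ * Expect d m p H
  ΣInjections-Expect-∘ Σp≈1 zero    k       H H-cong = begin
    Expect k m p (λ t → H (t ∘ (λ ())))   ≈⟨ Expect-cong k (λ t → H-cong (λ ())) ⟩
    Expect k m p (λ _ → H (λ ()))         ≈⟨ Expect-const Σp≈1 k (H (λ ())) ⟩
    H (λ ())                              ≈⟨ *-identityˡ _ ⟨
    1# * H (λ ())                         ≈⟨ *-identityˡ _ ⟨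
    1# * (1# * H (λ ()))                  ≈⟨ *-congʳ (+-identityʳ 1#) ⟨
    (1# + 0#) * (1# * H (λ ()))           ∎
    where open ≈-Reasoning setoid
  ΣInjections-Expect-∘ _    (suc d) zero    _ _      = sym (zeroˡ _)
  ΣInjections-Expect-∘ Σp≈1 (suc d) (suc k) H H-cong = begin
    Σ (suc k) (λ j → ΣInjections d k (λ σ → Expect (suc k) m p (λ t → H (t ∘ consInj j σ))))
      ≈⟨ Σ-cong (suc k) firstValue ⟩
    Σ (suc k) (λ _ → ⟦ falling k d ⟧ * Expect (suc d) m p H)
      ≈⟨ Σ-const (suc k) _ ⟩
    ⟦ suc k ⟧ * (⟦ falling k d ⟧ * Expect (suc d) m p H)
      ≈⟨ *-assoc _ _ _ ⟨
    (⟦ suc k ⟧ * ⟦ falling k d ⟧) * Expect (suc d) m p H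
      ≈⟨ *-congʳ (⟦⟧-* (suc k) (falling k d)) ⟨
    ⟦ falling (suc k) (suc d) ⟧ * Expect (suc d) m p H  ∎
    where
    open ≈-Reasoning setoid
    firstValue : ∀ j → ΣInjections d k (λ σ → Expect (suc k) m p (λ t → H (t ∘ consInj j σ))) ≈
                       ⟦ falling k d ⟧ * Expect (suc d) m p H
    firstValue j = begin
      ΣInjections d k (λ σ → Expect (suc k) m p (λ t → H (t ∘ consInj j σ)))
        ≈⟨ ΣInjections-cong d k (λ σ → Expect-cong (suc k) (λ t → H-cong (∘consInj t σ))) ⟩
      ΣInjections d k (λ σ → Expect (suc k) m p (λ t → H (cons (t j) (t ∘ punchIn j ∘ σ))))
        ≈⟨ ΣInjections-cong d k (λ σ → Expect-splitAt k j (λ a u → H (cons a (u ∘ σ)))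
                                                          (λ a u≗u′ → H-cong (cons-cong (u≗u′ ∘ σ)))) ⟩
      ΣInjections d k (λ σ → Σ m (λ a → p a * Expect k m p (λ u → H (cons a (u ∘ σ)))))
        ≈⟨ ΣInjections-Σ-comm d k m _ ⟩
      Σ m (λ a → ΣInjections d k (λ σ → p a * Expect k m p (λ u → H (cons a (u ∘ σ)))))
        ≈⟨ Σ-cong m (λ a → sym (*-distribˡ-ΣInjections d k (p a) _)) ⟩
      Σ m (λ a → p a * ΣInjections d k (λ σ → Expect k m p (λ u → H (cons a (u ∘ σ)))))
        ≈⟨ Σ-cong m (λ a → *-congˡ (ΣInjections-Expect-∘ Σp≈1 d k (H ∘ cons a) (H-cong ∘ cons-cong))) ⟩
      Σ m (λ a → p a * (⟦ falling k d ⟧ * Expect d m p (H ∘ cons a)))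
        ≈⟨ Σ-cong m (λ a → *-leftComm (p a) _ _) ⟩
      Σ m (λ a → ⟦ falling k d ⟧ * (p a * Expect d m p (H ∘ cons a)))
        ≈⟨ *-distribˡ-Σ m _ _ ⟨
      ⟦ falling k d ⟧ * Σ m (λ a → p a * Expect d m p (H ∘ cons a))
        ≈⟨ *-congˡ (Expect-suc d H) ⟨
      ⟦ falling k d ⟧ * Expect (suc d) m p H  ∎
      where
      ∘consInj : ∀ (t : Fin (suc k) → Fin m) σ → t ∘ consInj j σ ≗ cons (t j) (t ∘ punchIn j ∘ σ)
      ∘consInj t σ zero    = ≡.refl
      ∘consInj t σ (suc i) = ≡.refl

lemma3p5 : {c ℓ : Level} (R : CommutativeRing c ℓ) →
    let open CommutativeRing R
        open RingDefs R
    in (d m k : ℕ) → d ≤ k →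
       (kinv : Carrier) → ⟦ k ⟧ * kinv ≈ 1# →
       (v : Fin m → Vector d) (x : Fin m → Carrier) →
       Σ m x ≈ ⟦ k ⟧ →
       sgn d * fEmpty d m k v x kinv 0# ≈
         (⟦ falling k d ⟧ * pow kinv d) * det d (Xmat d m v x)
lemma3p5 R d m k _ kinv k*kinv≈1 v x Σx≈k = begin
  sgn d * fEmpty d m k v x kinv 0#
    ≈⟨ *-distribˡ-Expect k (sgn d) _ ⟩
  Expect k m p (λ t → sgn d * det d (scal d 0# (I d) ⊟ ΣM k (λ j → outer (v (t j)))))
    ≈⟨ Expect-cong k (λ t → trans (sgn-det-negate d _) (det-gram d k (v ∘ t))) ⟩
  Expect k m p (λ t → ΣTuples d k (λ σ → diagDet (v ∘ t ∘ σ)))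
    ≈⟨ Expect-ΣTuples-comm k d k (λ t σ → diagDet (v ∘ t ∘ σ)) ⟩
  ΣTuples d k (λ σ → Expect k m p (λ t → diagDet (v ∘ t ∘ σ)))
    ≈⟨ ΣTuples≈ΣInjections d k _
         (λ σ≗σ′ → Expect-cong k (λ t → diagDet-cong (≡.cong (v ∘ t) ∘ σ≗σ′)))
         (λ σ σ-nonInj → Expect-zero k (λ t → diagDet-nonInjective (v ∘ t) σ σ-nonInj)) ⟩
  ΣInjections d k (λ σ → Expect k m p (λ t → diagDet (v ∘ t ∘ σ)))
    ≈⟨ ΣInjections-Expect-∘ Σp≈1 d k (λ τ → diagDet (v ∘ τ))
                                      (λ τ≗τ′ → diagDet-cong (≡.cong v ∘ τ≗τ′)) ⟩
  ⟦ falling k d ⟧ * Expect d m p (λ τ → diagDet (v ∘ τ))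
    ≈⟨ *-congˡ (Expect-diagDet d m v x kinv) ⟩
  ⟦ falling k d ⟧ * (pow kinv d * det d (Xmat d m v x))
    ≈⟨ *-assoc _ _ _ ⟨
  (⟦ falling k d ⟧ * pow kinv d) * det d (Xmat d m v x)  ∎
  where
  open CommutativeRing R hiding (zero)
  open RingDefs R
  open Summation R
  open Tuples R
  open Determinant R
  open Gram R
  open ≈-Reasoning setoid
  p : Fin m → Carrier
  p a = x a * kinv
  open Expectation R p
  Σp≈1 : Σ m p ≈ 1#
  Σp≈1 = trans (sym (*-distribʳ-Σ m kinv x)) (trans (*-congʳ Σx≈k) k*kinv≈1)
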